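{- The function classes $1\#$ and $1\mathrm{Gap}$ are closed under addition and multiplication.
   Context: A one-way nondeterministic finite automaton (1nfa) is $M=(Q,\Sigma,\{\rhd,\lhd\},\delta,q_0,Q_{acc},Q_{rej})$: finite state set $Q$, input alphabet $\Sigma$, endmarkers $\rhd,\lhd\notin\Sigma$, disjoint sets $Q_{acc},Q_{rej}\subseteq Q$ ($Q_{halt}=Q_{acc}\cup Q_{rej}$), transition function $\delta:(Q-Q_{halt})\times(\Sigma\cup\{\rhd,\lhd\})\to\mathcal P(Q)$. On input $x$ it reads $\rhd x\lhd$ left to right, moving its head one cell right at every step (no $\lambda$-moves), halting on entering a halting state. A path is accepting (resp. rejecting) if it enters $Q_{acc}$ (resp. $Q_{rej}$), otherwise neither. $\#M(x)$, $\#\overline{M}(x)$ are the numbers of accepting and rejecting paths on $x$. A family $\{M_n\}_{n\in\mathbb N}$ has polynomial size if $|Q_n|\le p(n)$ for a fixed polynomial $p$. A family of partial functions over a fixed alphabet $\Sigma$ is $\{(f_n,D_n)\}_{n\in\mathbb N}$, $f_n$ defined on $D_n\subseteq\Sigma^*$. $1\#$ (resp. $1\mathrm{Gap}$) is the class of such families for which a polynomial-size family of 1nfa's satisfies $f_n(x)=\#M_n(x)$ (resp. $f_n(x)=\#M_n(x)-\#\overline{M}_n(x)$) for all $n$, $x\in D_n$. A class is closed under a binary operation $\circ$ if for any two families $\{(f_n,D_n)\}$, $\{(g_n,E_n)\}$ in it, $\{(f_n\circ g_n,D_n\cap E_n)\}_n$ with $(f_n\circ g_n)(x)=f_n(x)\circ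 g_n(x)$ is also in it. -}

module Defs where

open import Data.Nat using (ℕ; zero; suc; _+_; _*_; _^_; _≤_)
open import Data.Integer as ℤ using (ℤ)
open import Data.Fin using (Fin; zero; suc)
open import Data.List using (List; []; _∷_; map; _++_)
open import Data.Bool using (Bool; true; false; if_then_else_)
open import Data.Product using (Σ; _×_; _,_; ∃; ∃-syntax)
open import Relation.Binary.PropositionalEquality using (_≡_)

-- Tape symbols over the alphabet Σ = Fin s, plus the two endmarkers ▷ (left) and ◁ (right).
data Sym (s : ℕ) : Set where
  sym   : Fin s → Sym s
  lend  : Sym s
  rend  : Sym s

-- Status of a state: accepting (Q_acc), rejecting (Q_rej), or non-halting.
-- Encoding by a single function makes Q_acc and Q_rej disjoint by construction.
data Status : Set where
  acc rej cont : Status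

-- A 1nfa with state set Fin states over alphabet Fin s.
-- δ q a is the subset of Fin states given by its characteristic function;
-- it is only ever consulted at non-halting states.
record NFA (s : ℕ) : Set where
  field
    states : ℕ
    δ      : Fin states → Sym s → Fin states → Bool
    q₀     : Fin states
    status : Fin states → Status
open NFA public

sumFin : (n : ℕ) → (Fin n → ℕ) → ℕ
sumFin zero    f = 0
sumFin (suc n) f = f zero + sumFin n (λ i → f (suc i))

-- Number of accepting (resp. rejecting) computation paths starting in state q
-- with the remaining tape w. The head moves right each step; a path halts on
-- entering a halting state; a path that moves past ◁ without halting, or has no
-- transition, is neither accepting nor rejecting.
module _ {s : ℕ} (M : NFA s) where
  countFrom : Status → Fin (states M) → List (Sym s) → ℕ
  countFrom t q w with status M q
  countFrom acc q w | acc = 1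
  countFrom rej q w | acc = 0
  countFrom cont q w | acc = 0
  countFrom acc q w | rej = 0
  countFrom rej q w | rej = 1
  countFrom cont q w | rej = 0
  countFrom t q [] | cont = 0
  countFrom t q (a ∷ w) | cont =
    sumFin (states M) (λ q' → if δ M q a q' then countFrom t q' w else 0)

tape : {s : ℕ} → List (Fin s) → List (Sym s)
tape x = lend ∷ map sym x ++ (rend ∷ [])

#acc : {s : ℕ} → NFA s → List (Fin s) → ℕ
#acc M x = countFrom M acc (q₀ M) (tape x)

#rej : {s : ℕ} → NFA s → List (Fin s) → ℕ
#rej M x = countFrom M rej (q₀ M) (tape x)

-- Polynomials with natural-number coefficients (coefficient list, constant term first).
evalPoly : List ℕ → ℕ → ℕ
evalPoly []       n = 0
evalPoly (c ∷ cs) n = c + n * evalPoly cs n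

PolySize : {s : ℕ} → (ℕ → NFA s) → Set
PolySize M = ∃[ p ] (∀ n → states (M n) ≤ evalPoly p n)

-- A family {(f_n, D_n)} of partial functions Σ* ⇀ A (Σ = Fin s):
-- D n is the domain predicate, f n x is defined on x with D n x.
record PFam (s : ℕ) (A : Set) : Set₁ where
  field
    D : ℕ → List (Fin s) → Set
    f : (n : ℕ) (x : List (Fin s)) → D n x → A
open PFam public

In1Sharp : {s : ℕ} → PFam s ℕ → Set
In1Sharp {s} F = Σ (ℕ → NFA s) λ M → PolySize M ×
  (∀ n x (d : D F n x) → f F n x d ≡ #acc (M n) x)

In1Gap : {s : ℕ} → PFam s ℤ → Set
In1Gap {s} F = Σ (ℕ → NFA s) λ M → PolySize M ×
  (∀ n x (d : D F n x) → f F n x d ≡ ℤ.+ (#acc (M n) x) ℤ.- ℤ.+ (#rej (M n) x))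

combine : {s : ℕ} {A : Set} → (A → A → A) → PFam s A → PFam s A → PFam s A
combine _∘_ F G = record
  { D = λ n x → D F n x × D G n x
  ; f = λ { n x (d , e) → f F n x d ∘ f G n x e } }

ClosedUnder : {s : ℕ} {A : Set} → (PFam s A → Set) → (A → A → A) → Set₁
ClosedUnder C _∘_ = ∀ F G → C F → C G → C (combine _∘_ F G)

-- The numbers of accepting and of rejecting paths of a 1nfa are the unique solution of the
-- recursion "a halted state contributes its own verdict, a running state sums over its
-- successors", so it suffices to check that a proposed count satisfies that recursion.
-- For a sum, place both automata side by side behind a fresh start state: the paths are those
-- of M₁ together with those of M₂. For a product, run both in lockstep, an automaton that has
-- halted staying where it is until the other one halts; the paths are then the pairs of paths,
-- and a pair receives the verdict comb b₁ b₂ of its two verdicts. With comb = ∧ the numbers of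
-- accepting paths multiply; with comb = "the verdicts agree" the gaps multiply, because
-- (A₁ − R₁)(A₂ − R₂) = (A₁A₂ + R₁R₂) − (A₁R₂ + R₁A₂).
module Submission where

open import Defs hiding (sym)
open import Data.Nat using (ℕ)
open import Data.Product using (_×_)
import Data.Nat as N
import Data.Integer as Z

open import Data.Bool using (Bool; true; false; if_then_else_; _∧_)
import Data.Bool.Properties as Bool
open import Data.Empty using (⊥-elim)
open import Data.Fin as Fin using (Fin; zero; suc; splitAt; remQuot; quotRem; _≟_)
open import Data.Fin.Properties using (remQuot-combine)
open import Data.Integer using (ℤ; _-_)
open import Data.Integer.Properties using (pos-+; pos-*)
open import Data.Integer.Tactic.RingSolver renaming (solve-∀ to ℤ-solve-∀)
open import Data.List using (List; []; _∷_; map)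
open import Data.Nat using (zero; suc; _+_; _*_; s≤s)
open import Data.Nat.Properties
  using (+-*-semiring; +-assoc; +-identityʳ; *-zeroʳ; +-mono-≤; *-mono-≤; ≤-trans; ≤-reflexive;
         module ≤-Reasoning)
open import Data.Nat.Tactic.RingSolver using (solve-∀)
open import Data.Product using (Σ; _,_; proj₁; proj₂; swap; map₂; ∃-syntax)
open import Data.Sum using (_⊎_; inj₁; inj₂; [_,_]′; map₁)
open import Function using (_∘_)
open import Relation.Nullary using (does)
open import Relation.Binary.PropositionalEquality

open import Algebra.Properties.Semiring.Sum +-*-semiring
  using (sum-syntax; ∑-distrib-+; *-distribˡ-sum; *-distribʳ-sum; sum-cong-≗; sum-replicate-zero)

mask : Bool → ℕ → ℕ
mask b x = if b then x else 0

sumFin≡∑ : ∀ n (f : Fin n → ℕ) → sumFin n f ≡ ∑[ i < n ] f i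
sumFin≡∑ zero    f = refl
sumFin≡∑ (suc n) f = cong (f zero +_) (sumFin≡∑ n (λ i → f (suc i)))

∑-splitAt : ∀ m {k} (f : Fin m ⊎ Fin k → ℕ) →
  ∑[ p < m + k ] f (splitAt m p) ≡ ∑[ i < m ] f (inj₁ i) + ∑[ j < k ] f (inj₂ j)
∑-splitAt zero    f = refl
∑-splitAt (suc m) f =
  trans (cong (f (inj₁ zero) +_) (∑-splitAt m (f ∘ map₁ suc))) (sym (+-assoc (f (inj₁ zero)) _ _))

∑-splitAt-inj₁ : ∀ m {k} (f : Fin m ⊎ Fin k → ℕ) → (∀ j → f (inj₂ j) ≡ 0) →
  ∑[ p < m + k ] f (splitAt m p) ≡ ∑[ i < m ] f (inj₁ i)
∑-splitAt-inj₁ m {k} f f≗0 = trans (∑-splitAt m f)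
  (trans (cong (∑[ i < m ] f (inj₁ i) +_) (trans (sum-cong-≗ f≗0) (sum-replicate-zero k))) (+-identityʳ _))

∑-splitAt-inj₂ : ∀ m {k} (f : Fin m ⊎ Fin k → ℕ) → (∀ i → f (inj₁ i) ≡ 0) →
  ∑[ p < m + k ] f (splitAt m p) ≡ ∑[ j < k ] f (inj₂ j)
∑-splitAt-inj₂ m {k} f f≗0 = trans (∑-splitAt m f)
  (cong (_+ ∑[ j < k ] f (inj₂ j)) (trans (sum-cong-≗ f≗0) (sum-replicate-zero m)))

∑-remQuot : ∀ m k (f : Fin m × Fin k → ℕ) →
  ∑[ p < m * k ] f (remQuot k p) ≡ ∑[ i < m ] ∑[ j < k ] f (i , j)
∑-remQuot zero    k f = refl
∑-remQuot (suc m) k f =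
  trans (∑-splitAt k (λ x → f (swap ([ (_, zero) , map₂ suc ∘ quotRem {m} k ]′ x))))
        (cong (∑[ j < k ] f (zero , j) +_) (∑-remQuot m k (λ (i , j) → f (suc i , j))))

∑-mask-≟ : ∀ {n} (q : Fin n) (f : Fin n → ℕ) → ∑[ i < n ] mask (does (q ≟ i)) (f i) ≡ f q
∑-mask-≟ {suc n} zero    f = trans (cong (f zero +_) (sum-replicate-zero n)) (+-identityʳ _)
∑-mask-≟ {suc n} (suc q) f = ∑-mask-≟ q (f ∘ suc)

∑𝔹 : (Bool → ℕ) → ℕ
∑𝔹 f = f true + f false

kronecker : Bool → Bool → ℕ
kronecker true  true  = 1
kronecker false false = 1
kronecker _     _     = 0

∑𝔹-kronecker : ∀ b (f : Bool → ℕ) → ∑𝔹 (λ c → kronecker b c * f c) ≡ f b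
∑𝔹-kronecker true  f = trans (+-identityʳ _) (+-identityʳ (f true))
∑𝔹-kronecker false f = +-identityʳ (f false)

∑-∑𝔹-*ʳ : ∀ n (x : Fin n → Bool → ℕ) (K : Bool → ℕ) →
  ∑[ i < n ] ∑𝔹 (λ b → x i b * K b) ≡ ∑𝔹 (λ b → (∑[ i < n ] x i b) * K b)
∑-∑𝔹-*ʳ n x K = trans (∑-distrib-+ {n} (λ i → x i true * K true) (λ i → x i false * K false))
  (cong₂ _+_ (sym (*-distribʳ-sum (K true) (λ i → x i true)))
             (sym (*-distribʳ-sum (K false) (λ i → x i false))))

bilinear : (Bool → Bool → ℕ) → (Bool → ℕ) → (Bool → ℕ) → ℕ
bilinear K u v = ∑𝔹 λ b → u b * ∑𝔹 λ c → v c * K b c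

bilinear-cong : ∀ K {u u′ v v′} → (∀ b → u b ≡ u′ b) → (∀ c → v c ≡ v′ c) →
  bilinear K u v ≡ bilinear K u′ v′
bilinear-cong K {u} {u′} {v} {v′} u≗u′ v≗v′ = cong₂ _+_ (row true) (row false)
  where
  row : ∀ b → u b * ∑𝔹 (λ c → v c * K b c) ≡ u′ b * ∑𝔹 (λ c → v′ c * K b c)
  row b = cong₂ _*_ (u≗u′ b) (cong₂ _+_ (cong (_* K b true) (v≗v′ true)) (cong (_* K b false) (v≗v′ false)))

bilinear-kronecker : ∀ K b c → bilinear K (kronecker b) (kronecker c) ≡ K b c
bilinear-kronecker K b c =
  trans (∑𝔹-kronecker b (λ b′ → ∑𝔹 λ c′ → kronecker c c′ * K b′ c′)) (∑𝔹-kronecker c (K b))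

bilinear-vanishˡ : ∀ K {u} v → (∀ b → u b ≡ 0) → bilinear K u v ≡ 0
bilinear-vanishˡ K v u≗0 = cong₂ _+_ (cong (_* _) (u≗0 true)) (cong (_* _) (u≗0 false))

bilinear-vanishʳ : ∀ K u {v} → (∀ c → v c ≡ 0) → bilinear K u v ≡ 0
bilinear-vanishʳ K u {v} v≗0 = cong₂ _+_ (row true) (row false)
  where
  row : ∀ b → u b * ∑𝔹 (λ c → v c * K b c) ≡ 0
  row b = trans (cong (u b *_) (cong₂ _+_ (cong (_* K b true) (v≗0 true)) (cong (_* K b false) (v≗0 false))))
                (*-zeroʳ (u b))

∑-bilinearˡ : ∀ n K (x : Fin n → Bool → ℕ) v →
  ∑[ i < n ] bilinear K (x i) v ≡ bilinear K (λ b → ∑[ i < n ] x i b) v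
∑-bilinearˡ n K x v = ∑-∑𝔹-*ʳ n x (λ b → ∑𝔹 λ c → v c * K b c)

∑-bilinearʳ : ∀ n K u (y : Fin n → Bool → ℕ) →
  ∑[ j < n ] bilinear K u (y j) ≡ bilinear K u (λ c → ∑[ j < n ] y j c)
∑-bilinearʳ n K u y =
  trans (∑-distrib-+ {n} (λ j → u true * _) (λ j → u false * _)) (cong₂ _+_ (row true) (row false))
  where
  row : ∀ b → ∑[ j < n ] (u b * ∑𝔹 λ c → y j c * K b c) ≡ u b * ∑𝔹 λ c → (∑[ j < n ] y j c) * K b c
  row b = trans (sym (*-distribˡ-sum {n} (u b) (λ j → ∑𝔹 λ c → y j c * K b c)))
                (cong (u b *_) (∑-∑𝔹-*ʳ n y (K b)))

mask-bilinear : ∀ K u v m m′ → mask (m ∧ m′) (bilinear K u v) ≡ bilinear K (mask m ∘ u) (mask m′ ∘ v)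
mask-bilinear K u v false m′    = refl
mask-bilinear K u v true  false = sym (bilinear-vanishʳ K u (λ _ → refl))
mask-bilinear K u v true  true  = refl

agree : Bool → Bool → Bool
agree b c = does (b Bool.≟ c)

bilinear-∧ : ∀ u v → bilinear (λ b c → kronecker (b ∧ c) true) u v ≡ u true * v true
bilinear-∧ u v = expand (u true) (u false) (v true) (v false)
  where
  expand : ∀ a r a′ r′ → a * (a′ * 1 + r′ * 0) + r * (a′ * 0 + r′ * 0) ≡ a * a′
  expand = solve-∀

bilinear-agree-true : ∀ u v →
  bilinear (λ b c → kronecker (agree b c) true) u v ≡ u true * v true + u false * v false
bilinear-agree-true u v = expand (u true) (u false) (v true) (v false)
  where
  expand : ∀ a r a′ r′ → a * (a′ * 1 + r′ * 0) + r * (a′ * 0 + r′ * 1) ≡ a * a′ + r * r′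
  expand = solve-∀

bilinear-agree-false : ∀ u v →
  bilinear (λ b c → kronecker (agree b c) false) u v ≡ u true * v false + u false * v true
bilinear-agree-false u v = expand (u true) (u false) (v true) (v false)
  where
  expand : ∀ a r a′ r′ → a * (a′ * 0 + r′ * 1) + r * (a′ * 1 + r′ * 0) ≡ a * r′ + r * a′
  expand = solve-∀

running : Status → Bool
running cont = true
running _    = false

verdict : Bool → Status
verdict true  = acc
verdict false = rej

verdict-injective : ∀ {b c} → verdict b ≡ verdict c → b ≡ c
verdict-injective {true}  {true}  _ = refl
verdict-injective {false} {false} _ = refl
verdict-injective {true}  {false} ()
verdict-injective {false} {true}  ()

verdict≢cont : ∀ b → verdict b ≢ cont
verdict≢cont true  ()
verdict≢cont false ()

running-or-halted : ∀ t → t ≡ cont ⊎ ∃[ b ] t ≡ verdict b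
running-or-halted acc  = inj₂ (true , refl)
running-or-halted rej  = inj₂ (false , refl)
running-or-halted cont = inj₁ refl

module _ {s : ℕ} (M : NFA s) where

  countFrom-halted : ∀ {q b} v w → status M q ≡ verdict b → countFrom M (verdict v) q w ≡ kronecker b v
  countFrom-halted {b = true}  true  w eq rewrite eq = refl
  countFrom-halted {b = true}  false w eq rewrite eq = refl
  countFrom-halted {b = false} true  w eq rewrite eq = refl
  countFrom-halted {b = false} false w eq rewrite eq = refl

  countFrom-stuck : ∀ {q} v → status M q ≡ cont → countFrom M (verdict v) q [] ≡ 0
  countFrom-stuck v eq rewrite eq = refl

  countFrom-step : ∀ {q} v a w → status M q ≡ cont →
    countFrom M (verdict v) q (a ∷ w) ≡ ∑[ q′ < states M ] mask (δ M q a q′) (countFrom M (verdict v) q′ w)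
  countFrom-step v a w eq rewrite eq = sumFin≡∑ (states M) _

  -- A halted state stays put, so that in a product a halted component waits for the other one.
  move : Fin (states M) → Sym s → Fin (states M) → Bool
  move q a q′ = if running (status M q) then δ M q a q′ else does (q ≟ q′)

  move-running : ∀ {q} a q′ → status M q ≡ cont → move q a q′ ≡ δ M q a q′
  move-running a q′ eq rewrite eq = refl

  move-halted : ∀ {q b} a q′ → status M q ≡ verdict b → move q a q′ ≡ does (q ≟ q′)
  move-halted {b = true}  a q′ eq rewrite eq = refl
  move-halted {b = false} a q′ eq rewrite eq = refl

  countFrom-move : ∀ v q a w →
    countFrom M (verdict v) q (a ∷ w) ≡ ∑[ q′ < states M ] mask (move q a q′) (countFrom M (verdict v) q′ w)
  countFrom-move v q a w with running-or-halted (status M q)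
  ... | inj₁ r =
    trans (countFrom-step v a w r) (sum-cong-≗ λ q′ → cong (λ m → mask m _) (sym (move-running a q′ r)))
  ... | inj₂ (b , h) = begin
    countFrom M (verdict v) q (a ∷ w)                                      ≡⟨ countFrom-halted v (a ∷ w) h ⟩
    kronecker b v                                                          ≡⟨ countFrom-halted v w h ⟨
    countFrom M (verdict v) q w                                            ≡⟨ ∑-mask-≟ q _ ⟨
    ∑[ q′ < states M ] mask (does (q ≟ q′)) (countFrom M (verdict v) q′ w)
      ≡⟨ sum-cong-≗ (λ q′ → cong (λ m → mask m _) (move-halted a q′ h)) ⟨
    ∑[ q′ < states M ] mask (move q a q′) (countFrom M (verdict v) q′ w)   ∎
    where open ≡-Reasoning

  record IsPathCount (v : Bool) (g : Fin (states M) → List (Sym s) → ℕ) : Set where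
    field
      halted : ∀ {q b} w → status M q ≡ verdict b → g q w ≡ kronecker b v
      stuck  : ∀ {q} → status M q ≡ cont → g q [] ≡ 0
      step   : ∀ {q} a w → status M q ≡ cont → g q (a ∷ w) ≡ ∑[ q′ < states M ] mask (δ M q a q′) (g q′ w)

  countFrom-unique : ∀ {v g} → IsPathCount v g → ∀ q w → g q w ≡ countFrom M (verdict v) q w
  countFrom-unique {v} G q w with running-or-halted (status M q)
  ... | inj₂ (b , h) = trans (IsPathCount.halted G w h) (sym (countFrom-halted v w h))
  countFrom-unique {v} G q [] | inj₁ r = trans (IsPathCount.stuck G r) (sym (countFrom-stuck v r))
  countFrom-unique {v} {g} G q (a ∷ w) | inj₁ r = begin
    g q (a ∷ w)                                                         ≡⟨ IsPathCount.step G a w r ⟩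
    ∑[ q′ < states M ] mask (δ M q a q′) (g q′ w)
      ≡⟨ sum-cong-≗ (λ q′ → cong (mask _) (countFrom-unique G q′ w)) ⟩
    ∑[ q′ < states M ] mask (δ M q a q′) (countFrom M (verdict v) q′ w)  ≡⟨ countFrom-step v a w r ⟨
    countFrom M (verdict v) q (a ∷ w)                                   ∎
    where open ≡-Reasoning

module _ (comb : Bool → Bool → Bool) where

  joint : Status → Status → Status
  joint acc acc = verdict (comb true true)
  joint acc rej = verdict (comb true false)
  joint rej acc = verdict (comb false true)
  joint rej rej = verdict (comb false false)
  joint _   _   = cont

  joint-halted : ∀ {s₁ s₂ b₁ b₂} → s₁ ≡ verdict b₁ → s₂ ≡ verdict b₂ → joint s₁ s₂ ≡ verdict (comb b₁ b₂)
  joint-halted {b₁ = true}  {true}  refl refl = refl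
  joint-halted {b₁ = true}  {false} refl refl = refl
  joint-halted {b₁ = false} {true}  refl refl = refl
  joint-halted {b₁ = false} {false} refl refl = refl

  joint-runningˡ : ∀ {s₁} s₂ → s₁ ≡ cont → joint s₁ s₂ ≡ cont
  joint-runningˡ s₂ refl = refl

  joint-runningʳ : ∀ s₁ {s₂} → s₂ ≡ cont → joint s₁ s₂ ≡ cont
  joint-runningʳ acc  refl = refl
  joint-runningʳ rej  refl = refl
  joint-runningʳ cont refl = refl

module _ (comb : Bool → Bool → Bool) {s : ℕ} (M₁ M₂ : NFA s) where
  private
    m = states M₁
    k = states M₂

  unpair : Fin (m * k) → Fin m × Fin k
  unpair = remQuot k

  moves : Fin m × Fin k → Sym s → Fin m × Fin k → Bool
  moves (i , j) a (i′ , j′) = move M₁ i a i′ ∧ move M₂ j a j′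

  product : NFA s
  product = record
    { states = m * k
    ; δ      = λ p a p′ → moves (unpair p) a (unpair p′)
    ; q₀     = Fin.combine (q₀ M₁) (q₀ M₂)
    ; status = λ p → joint comb (status M₁ (proj₁ (unpair p))) (status M₂ (proj₂ (unpair p)))
    }

  -- Pairs of paths with verdicts b and c, weighted by whether comb b c is the verdict v.
  productCount : Bool → Fin m × Fin k → List (Sym s) → ℕ
  productCount v (i , j) w = bilinear (λ b c → kronecker (comb b c) v)
    (λ b → countFrom M₁ (verdict b) i w) (λ c → countFrom M₂ (verdict c) j w)

  product-isPathCount : ∀ v → IsPathCount product v (λ p → productCount v (unpair p))
  product-isPathCount v = record
    { halted = λ {p} → halted (proj₁ (unpair p)) (proj₂ (unpair p))
    ; stuck  = λ {p} → stuck (proj₁ (unpair p)) (proj₂ (unpair p))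
    ; step   = λ {p} a w _ → step (proj₁ (unpair p)) (proj₂ (unpair p)) a w
    }
    where
    open ≡-Reasoning

    K : Bool → Bool → ℕ
    K b c = kronecker (comb b c) v

    halted : ∀ i j {b} w → joint comb (status M₁ i) (status M₂ j) ≡ verdict b →
      productCount v (i , j) w ≡ kronecker b v
    halted i j {b} w eq with running-or-halted (status M₁ i) | running-or-halted (status M₂ j)
    ... | inj₁ r₁ | _       = ⊥-elim (verdict≢cont b (trans (sym eq) (joint-runningˡ comb (status M₂ j) r₁)))
    ... | inj₂ _  | inj₁ r₂ = ⊥-elim (verdict≢cont b (trans (sym eq) (joint-runningʳ comb (status M₁ i) r₂)))
    ... | inj₂ (b₁ , h₁) | inj₂ (b₂ , h₂) = begin
      productCount v (i , j) w
        ≡⟨ bilinear-cong K (λ b → countFrom-halted M₁ b w h₁) (λ c → countFrom-halted M₂ c w h₂) ⟩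
      bilinear K (kronecker b₁) (kronecker b₂)
        ≡⟨ bilinear-kronecker K b₁ b₂ ⟩
      kronecker (comb b₁ b₂) v
        ≡⟨ cong (λ c → kronecker c v) (verdict-injective (trans (sym (joint-halted comb h₁ h₂)) eq)) ⟩
      kronecker b v ∎

    stuck : ∀ i j → joint comb (status M₁ i) (status M₂ j) ≡ cont → productCount v (i , j) [] ≡ 0
    stuck i j eq with running-or-halted (status M₁ i) | running-or-halted (status M₂ j)
    ... | inj₁ r₁ | _       =
      bilinear-vanishˡ K (λ c → countFrom M₂ (verdict c) j []) (λ b → countFrom-stuck M₁ b r₁)
    ... | inj₂ _  | inj₁ r₂ =
      bilinear-vanishʳ K (λ b → countFrom M₁ (verdict b) i []) (λ c → countFrom-stuck M₂ c r₂)
    ... | inj₂ (_ , h₁) | inj₂ (_ , h₂) = ⊥-elim (verdict≢cont _ (trans (sym (joint-halted comb h₁ h₂)) eq))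

    step : ∀ i j a w → productCount v (i , j) (a ∷ w)
      ≡ ∑[ p′ < m * k ] mask (moves (i , j) a (unpair p′)) (productCount v (unpair p′) w)
    step i j a w = begin
      productCount v (i , j) (a ∷ w)
        ≡⟨ bilinear-cong K (λ b → countFrom-move M₁ b i a w) (λ c → countFrom-move M₂ c j a w) ⟩
      bilinear K (λ b → ∑[ i′ < m ] x b i′) (λ c → ∑[ j′ < k ] y c j′)
        ≡⟨ ∑-bilinearˡ m K (λ i′ b → x b i′) (λ c → ∑[ j′ < k ] y c j′) ⟨
      ∑[ i′ < m ] bilinear K (λ b → x b i′) (λ c → ∑[ j′ < k ] y c j′)
        ≡⟨ sum-cong-≗ (λ i′ → ∑-bilinearʳ k K (λ b → x b i′) (λ j′ c → y c j′)) ⟨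
      ∑[ i′ < m ] ∑[ j′ < k ] bilinear K (λ b → x b i′) (λ c → y c j′)
        ≡⟨ sum-cong-≗ (λ i′ → sum-cong-≗ λ j′ →
             mask-bilinear K (λ b → countFrom M₁ (verdict b) i′ w) (λ c → countFrom M₂ (verdict c) j′ w)
                           (move M₁ i a i′) (move M₂ j a j′)) ⟨
      ∑[ i′ < m ] ∑[ j′ < k ] mask (moves (i , j) a (i′ , j′)) (productCount v (i′ , j′) w)
        ≡⟨ ∑-remQuot m k (λ p′ → mask (moves (i , j) a p′) (productCount v p′ w)) ⟨
      ∑[ p′ < m * k ] mask (moves (i , j) a (unpair p′)) (productCount v (unpair p′) w) ∎
      where
      x : Bool → Fin m → ℕ
      x b i′ = mask (move M₁ i a i′) (countFrom M₁ (verdict b) i′ w)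
      y : Bool → Fin k → ℕ
      y c j′ = mask (move M₂ j a j′) (countFrom M₂ (verdict c) j′ w)

  countFrom-product : ∀ v i j w → countFrom product (verdict v) (Fin.combine i j) w ≡ productCount v (i , j) w
  countFrom-product v i j w =
    trans (sym (countFrom-unique product (product-isPathCount v) (Fin.combine i j) w))
          (cong (λ x → productCount v x w) (remQuot-combine {m} i j))

module _ {s : ℕ} (M₁ M₂ : NFA s) where
  private
    m = states M₁
    k = states M₂

  blockδ : Fin m ⊎ Fin k → Sym s → Fin m ⊎ Fin k → Bool
  blockδ (inj₁ i) a (inj₁ i′) = δ M₁ i a i′
  blockδ (inj₂ j) a (inj₂ j′) = δ M₂ j a j′
  blockδ _        _ _         = false

  -- From the fresh start state the first step is one of either automaton; using move rather than δ
  -- also covers an initial state that is already halting.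
  startδ : Sym s → Fin m ⊎ Fin k → Bool
  startδ a = [ move M₁ (q₀ M₁) a , move M₂ (q₀ M₂) a ]′

  unionδ : Fin (suc (m + k)) → Sym s → Fin (suc (m + k)) → Bool
  unionδ _       a zero     = false
  unionδ zero    a (suc p′) = startδ a (splitAt m p′)
  unionδ (suc p) a (suc p′) = blockδ (splitAt m p) a (splitAt m p′)

  unionStatus : Fin (suc (m + k)) → Status
  unionStatus zero    = cont
  unionStatus (suc p) = [ status M₁ , status M₂ ]′ (splitAt m p)

  union : NFA s
  union = record { states = suc (m + k) ; δ = unionδ ; q₀ = zero ; status = unionStatus }

  componentCount : Bool → Fin m ⊎ Fin k → List (Sym s) → ℕ
  componentCount v x w = [ (λ i → countFrom M₁ (verdict v) i w) , (λ j → countFrom M₂ (verdict v) j w) ]′ x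

  unionCount : Bool → Fin (suc (m + k)) → List (Sym s) → ℕ
  unionCount v zero    []        = 0
  unionCount v zero    w@(_ ∷ _) = countFrom M₁ (verdict v) (q₀ M₁) w + countFrom M₂ (verdict v) (q₀ M₂) w
  unionCount v (suc p) w         = componentCount v (splitAt m p) w

  union-isPathCount : ∀ v → IsPathCount union v (unionCount v)
  union-isPathCount v = record { halted = λ {p} → halted {p} ; stuck = λ {p} → stuck {p} ; step = λ {p} → step {p} }
    where
    halted : ∀ {p b} w → status union p ≡ verdict b → unionCount v p w ≡ kronecker b v
    halted {zero}  {b} w eq = ⊥-elim (verdict≢cont b (sym eq))
    halted {suc p} w eq with splitAt m p
    ... | inj₁ i = countFrom-halted M₁ v w eq
    ... | inj₂ j = countFrom-halted M₂ v w eq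

    stuck : ∀ {p} → status union p ≡ cont → unionCount v p [] ≡ 0
    stuck {zero}  eq = refl
    stuck {suc p} eq with splitAt m p
    ... | inj₁ i = countFrom-stuck M₁ v eq
    ... | inj₂ j = countFrom-stuck M₂ v eq

    step : ∀ {p} a w → status union p ≡ cont →
      unionCount v p (a ∷ w) ≡ ∑[ p′ < suc (m + k) ] mask (unionδ p a p′) (unionCount v p′ w)
    step {zero} a w _ =
      trans (cong₂ _+_ (countFrom-move M₁ v (q₀ M₁) a w) (countFrom-move M₂ v (q₀ M₂) a w))
            (sym (∑-splitAt m (λ x → mask (startδ a x) (componentCount v x w))))
    step {suc p} a w eq with splitAt m p
    ... | inj₁ i = trans (countFrom-step M₁ v a w eq)
      (sym (∑-splitAt-inj₁ m (λ x → mask (blockδ (inj₁ i) a x) (componentCount v x w)) (λ _ → refl)))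
    ... | inj₂ j = trans (countFrom-step M₂ v a w eq)
      (sym (∑-splitAt-inj₂ m (λ x → mask (blockδ (inj₂ j) a x) (componentCount v x w)) (λ _ → refl)))

  countFrom-union : ∀ v a w → countFrom union (verdict v) zero (a ∷ w)
    ≡ countFrom M₁ (verdict v) (q₀ M₁) (a ∷ w) + countFrom M₂ (verdict v) (q₀ M₂) (a ∷ w)
  countFrom-union v a w = sym (countFrom-unique union (union-isPathCount v) zero (a ∷ w))

infixl 6 _+ₚ_
infixl 7 _*ₚ_

_+ₚ_ : List ℕ → List ℕ → List ℕ
[]      +ₚ q       = q
(a ∷ p) +ₚ []      = a ∷ p
(a ∷ p) +ₚ (b ∷ q) = a + b ∷ p +ₚ q

_*ₚ_ : List ℕ → List ℕ → List ℕ
[]      *ₚ q = []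
(a ∷ p) *ₚ q = map (a *_) q +ₚ (0 ∷ p *ₚ q)

evalPoly-+ₚ : ∀ p q n → evalPoly (p +ₚ q) n ≡ evalPoly p n + evalPoly q n
evalPoly-+ₚ []      q       n = refl
evalPoly-+ₚ (a ∷ p) []      n = sym (+-identityʳ _)
evalPoly-+ₚ (a ∷ p) (b ∷ q) n =
  trans (cong (λ x → a + b + n * x) (evalPoly-+ₚ p q n)) (shuffle a b n _ _)
  where
  shuffle : ∀ a b n x y → a + b + n * (x + y) ≡ a + n * x + (b + n * y)
  shuffle = solve-∀

evalPoly-scale : ∀ a q n → evalPoly (map (a *_) q) n ≡ a * evalPoly q n
evalPoly-scale a []      n = sym (*-zeroʳ a)
evalPoly-scale a (b ∷ q) n =
  trans (cong (λ x → a * b + n * x) (evalPoly-scale a q n)) (shuffle a b n _)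
  where
  shuffle : ∀ a b n x → a * b + n * (a * x) ≡ a * (b + n * x)
  shuffle = solve-∀

evalPoly-*ₚ : ∀ p q n → evalPoly (p *ₚ q) n ≡ evalPoly p n * evalPoly q n
evalPoly-*ₚ []      q n = refl
evalPoly-*ₚ (a ∷ p) q n = begin
  evalPoly (map (a *_) q +ₚ (0 ∷ p *ₚ q)) n              ≡⟨ evalPoly-+ₚ (map (a *_) q) (0 ∷ p *ₚ q) n ⟩
  evalPoly (map (a *_) q) n + n * evalPoly (p *ₚ q) n
    ≡⟨ cong₂ (λ x y → x + n * y) (evalPoly-scale a q n) (evalPoly-*ₚ p q n) ⟩
  a * evalPoly q n + n * (evalPoly p n * evalPoly q n)   ≡⟨ shuffle a n (evalPoly p n) (evalPoly q n) ⟩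
  (a + n * evalPoly p n) * evalPoly q n                  ∎
  where
  open ≡-Reasoning
  shuffle : ∀ a n x y → a * y + n * (x * y) ≡ (a + n * x) * y
  shuffle = solve-∀

module _ {s : ℕ} where

  polySize-union : (M₁ M₂ : ℕ → NFA s) → PolySize M₁ → PolySize M₂ → PolySize (λ n → union (M₁ n) (M₂ n))
  polySize-union M₁ M₂ (p₁ , bound₁) (p₂ , bound₂) = (1 ∷ []) +ₚ (p₁ +ₚ p₂) , λ n → begin
    suc (states (M₁ n) + states (M₂ n)) ≤⟨ s≤s (+-mono-≤ (bound₁ n) (bound₂ n)) ⟩
    suc (evalPoly p₁ n + evalPoly p₂ n) ≡⟨ cong₂ (λ x y → suc (x + y)) (*-zeroʳ n) (evalPoly-+ₚ p₁ p₂ n) ⟨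
    suc (n * 0 + evalPoly (p₁ +ₚ p₂) n) ≡⟨ evalPoly-+ₚ (1 ∷ []) (p₁ +ₚ p₂) n ⟨
    evalPoly ((1 ∷ []) +ₚ (p₁ +ₚ p₂)) n ∎
    where open ≤-Reasoning

  polySize-product : ∀ comb (M₁ M₂ : ℕ → NFA s) → PolySize M₁ → PolySize M₂ →
    PolySize (λ n → product comb (M₁ n) (M₂ n))
  polySize-product comb M₁ M₂ (p₁ , bound₁) (p₂ , bound₂) = p₁ *ₚ p₂ , λ n →
    ≤-trans (*-mono-≤ (bound₁ n) (bound₂ n)) (≤-reflexive (sym (evalPoly-*ₚ p₁ p₂ n)))

gap : ∀ {s} → NFA s → List (Fin s) → ℤ
gap M x = Z.+ #acc M x - Z.+ #rej M x

difference-+ : ∀ a r a′ r′ → Z.+ (a + a′) - Z.+ (r + r′) ≡ (Z.+ a - Z.+ r) Z.+ (Z.+ a′ - Z.+ r′)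
difference-+ a r a′ r′ =
  trans (cong₂ _-_ (pos-+ a a′) (pos-+ r r′)) (regroup (Z.+ a) (Z.+ r) (Z.+ a′) (Z.+ r′))
  where
  regroup : ∀ a r a′ r′ → (a Z.+ a′) - (r Z.+ r′) ≡ (a - r) Z.+ (a′ - r′)
  regroup = ℤ-solve-∀

difference-* : ∀ a r a′ r′ →
  Z.+ (a * a′ + r * r′) - Z.+ (a * r′ + r * a′) ≡ (Z.+ a - Z.+ r) Z.* (Z.+ a′ - Z.+ r′)
difference-* a r a′ r′ =
  trans (cong₂ _-_ (pos-+-* a a′ r r′) (pos-+-* a r′ r a′)) (expand (Z.+ a) (Z.+ r) (Z.+ a′) (Z.+ r′))
  where
  pos-+-* : ∀ a b c d → Z.+ (a * b + c * d) ≡ Z.+ a Z.* Z.+ b Z.+ Z.+ c Z.* Z.+ d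
  pos-+-* a b c d = trans (pos-+ (a * b) (c * d)) (cong₂ Z._+_ (pos-* a b) (pos-* c d))
  expand : ∀ a r a′ r′ → (a Z.* a′ Z.+ r Z.* r′) - (a Z.* r′ Z.+ r Z.* a′) ≡ (a - r) Z.* (a′ - r′)
  expand = ℤ-solve-∀

module _ {s : ℕ} (M₁ M₂ : NFA s) (x : List (Fin s)) where
  private
    A₁ = #acc M₁ x
    R₁ = #rej M₁ x
    A₂ = #acc M₂ x
    R₂ = #rej M₂ x
    N₁ N₂ : Bool → ℕ
    N₁ b = countFrom M₁ (verdict b) (q₀ M₁) (tape x)
    N₂ c = countFrom M₂ (verdict c) (q₀ M₂) (tape x)

  #acc-union : #acc (union M₁ M₂) x ≡ A₁ + A₂
  #acc-union = countFrom-union M₁ M₂ true lend _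

  #rej-union : #rej (union M₁ M₂) x ≡ R₁ + R₂
  #rej-union = countFrom-union M₁ M₂ false lend _

  #acc-product-∧ : #acc (product _∧_ M₁ M₂) x ≡ A₁ * A₂
  #acc-product-∧ =
    trans (countFrom-product _∧_ M₁ M₂ true (q₀ M₁) (q₀ M₂) (tape x)) (bilinear-∧ N₁ N₂)

  #acc-product-agree : #acc (product agree M₁ M₂) x ≡ A₁ * A₂ + R₁ * R₂
  #acc-product-agree =
    trans (countFrom-product agree M₁ M₂ true (q₀ M₁) (q₀ M₂) (tape x)) (bilinear-agree-true N₁ N₂)

  #rej-product-agree : #rej (product agree M₁ M₂) x ≡ A₁ * R₂ + R₁ * A₂
  #rej-product-agree =
    trans (countFrom-product agree M₁ M₂ false (q₀ M₁) (q₀ M₂) (tape x)) (bilinear-agree-false N₁ N₂)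

  gap-union : gap (union M₁ M₂) x ≡ gap M₁ x Z.+ gap M₂ x
  gap-union = trans (cong₂ (λ a r → Z.+ a - Z.+ r) #acc-union #rej-union) (difference-+ A₁ R₁ A₂ R₂)

  gap-product : gap (product agree M₁ M₂) x ≡ gap M₁ x Z.* gap M₂ x
  gap-product = trans (cong₂ (λ a r → Z.+ a - Z.+ r) #acc-product-agree #rej-product-agree)
                      (difference-* A₁ R₁ A₂ R₂)

module _ {s : ℕ} {A : Set} (count : NFA s → List (Fin s) → A) where

  CountedBy : PFam s A → Set
  CountedBy F = Σ (ℕ → NFA s) λ M → PolySize M × (∀ n x (d : D F n x) → f F n x d ≡ count (M n) x)

  closed-by : ∀ (_∘_ : A → A → A) (C : NFA s → NFA s → NFA s) →
    (∀ M₁ M₂ → PolySize M₁ → PolySize M₂ → PolySize (λ n → C (M₁ n) (M₂ n))) →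
    (∀ M₁ M₂ x → count (C M₁ M₂) x ≡ count M₁ x ∘ count M₂ x) →
    ClosedUnder CountedBy _∘_
  closed-by _∘_ C size count-C F G (M₁ , size₁ , F≡M₁) (M₂ , size₂ , G≡M₂) =
    (λ n → C (M₁ n) (M₂ n)) , size M₁ M₂ size₁ size₂ ,
    λ n x (d , e) → trans (cong₂ _∘_ (F≡M₁ n x d) (G≡M₂ n x e)) (sym (count-C (M₁ n) (M₂ n) x))

lemma3p5 : (s : ℕ) →
    ClosedUnder (In1Sharp {s}) N._+_ × ClosedUnder (In1Sharp {s}) N._*_ ×
    ClosedUnder (In1Gap {s}) Z._+_ × ClosedUnder (In1Gap {s}) Z._*_
lemma3p5 s =
  closed-by #acc _+_ union polySize-union #acc-union ,
  closed-by #acc _*_ (product _∧_) (polySize-product _∧_) #acc-product-∧ ,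
  closed-by gap Z._+_ union polySize-union gap-union ,
  closed-by gap Z._*_ (product agree) (polySize-product agree) gap-product
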